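{- In the setting described in the context, let $X$ be a component (a $1$-$1$-path or an $M$-$M^*$-path), let $u$ be the node that creates $X$, and let $d(u)$ be the degree of $u$ in the current graph at the beginning of the step in which $u$ creates $X$. Then $X$ has two missing debits if at least one of the following holds: (a) $d(u)\le\Delta-2$; (b) $d(u)=\Delta$; (c) $\Delta\ge 4$; (d) $X$ is a $1$-$1$-path.
   Context: Let $\Delta\ge 3$ and let $G=(V,E)$ be a finite simple graph with all degrees at most $\Delta$. A min-degree greedy algorithm proceeds in steps on a current graph (initially $G$): in each step, if the current graph has an edge, it chooses a node $u$ of minimum degree among the non-isolated nodes of the current graph ("$u$ is selected"), chooses any neighbor $v$ of $u$ in the current graph, adds $\{u,v\}$ to $M$ (initially empty), and deletes $u$, $v$ and all their incident edges; otherwise it stops. Let $M$ be the resulting matching; $d(x)$ denotes degree in the current graph at the time referred to. Fix a maximum matching $M^*$ such that every connected component $X$ of $(V,M\cup M^*)$ with at least one edge is either a single edge of $M\cap M^*$ (a $1$-$1$-path), or a path of $m_X\ge1$ edges of $M$ and $m_X+1$ edges of $M^*$ alternating, with first and last edge in $M^*$ (an $M$-$M^*$-path; its end nodes are not covered by $M$). Let $F=E\setminus(M\cup M^*)$. An edge $\{v,w\}\in F$ with $v$ covered by $M$ and $w$ an endpoint of an $M$-$M^*$-path is a transfer if, where $s$ is the step in which $v$ is deleted, $d(w)\le\Delta-2$ at the end of step $s$. The number of debits $d_X$ of a component $X$ is the number of transfers $\{v,w\}$ with $v$ a node of $X$. The maximum possible number of debits is $2(\Delta-1)$ for a $1$-$1$-path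 and $2m_X(\Delta-2)$ for an $M$-$M^*$-path; $X$ has two missing debits if $d_X$ is at most this maximum minus $2$. A node $u$ creates $X$ if the first edge of $M$ lying in $X$ that the algorithm adds is added in a step in which $u$ is the selected minimum-degree node. -}

module Defs where

open import Data.Nat using (ℕ; zero; suc; _+_; _*_; _∸_; _≤_; _<_; _<ᵇ_)
open import Data.Bool using (Bool; true; false; not; _∧_; _∨_)
open import Data.Fin using (Fin; toℕ; _≟_)
open import Data.List using (List; length; filterᵇ; allFin)
open import Data.Bool.ListAction using (any)
open import Data.List.Relation.Unary.All using (All)
open import Data.List.Relation.Unary.Unique.Propositional using (Unique)
open import Data.Maybe using (Maybe; just; Is-just)
open import Data.Product using (Σ; _×_; _,_; proj₁; proj₂)
open import Data.Sum using (_⊎_)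
open import Relation.Nullary using (¬_; ⌊_⌋)
open import Relation.Binary.PropositionalEquality using (_≡_; _≢_)

record Graph (n : ℕ) : Set where
  field
    adj    : Fin n → Fin n → Bool
    sym    : ∀ x y → adj x y ≡ adj y x
    irrefl : ∀ x → adj x x ≡ false
open Graph public

_==_ : ∀ {n} → Fin n → Fin n → Bool
x == y = ⌊ x ≟ y ⌋

countV : ∀ n → (Fin n → Bool) → ℕ
countV n p = length (filterᵇ p (allFin n))

degG : ∀ {n} → Graph n → Fin n → ℕ
degG {n} G x = countV n (λ y → adj G x y)

MaxDegree≤ : ∀ {n} → Graph n → ℕ → Set
MaxDegree≤ G Δ = ∀ x → degG G x ≤ Δ

-- Data of an instance: graph, maximum degree bound Δ, a run of the
-- algorithm (k steps; step j chooses the pair (u_j , v_j) = st j,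
-- u_j the selected min-degree node, v_j its chosen neighbour), and the
-- matching M* given by a partial "mate" function.

record Instance : Set where
  field
    n    : ℕ
    Δ    : ℕ
    G    : Graph n
    k    : ℕ
    st   : Fin k → Fin n × Fin n
    mate : Fin n → Maybe (Fin n)
open Instance public

module _ (I : Instance) where
  private
    N = n I
    V = Fin (n I)
    K = k I

  sel : Fin K → V
  sel j = proj₁ (st I j)

  nbr : Fin K → V
  nbr j = proj₂ (st I j)

  -- x deleted within the first t steps (steps 0 .. t-1)
  deletedBy : ℕ → V → Bool
  deletedBy t x = any (λ j → (toℕ j <ᵇ t) ∧ ((x == sel j) ∨ (x == nbr j))) (allFin K)

  alive : ℕ → V → Bool
  alive t x = not (deletedBy t x)

  -- degree of x in the current graph after t steps
  -- (current graph = G minus the deleted nodes and their incident edges)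
  deg : ℕ → V → ℕ
  deg t x = countV N (λ y → adj (G I) x y ∧ alive t y)

  record GreedyRun : Set where
    field
      sel-alive : ∀ j → alive (toℕ j) (sel j) ≡ true
      nbr-alive : ∀ j → alive (toℕ j) (nbr j) ≡ true
      sel-adj   : ∀ j → adj (G I) (sel j) (nbr j) ≡ true
      sel-min   : ∀ j y → alive (toℕ j) y ≡ true → 0 < deg (toℕ j) y →
                  deg (toℕ j) (sel j) ≤ deg (toℕ j) y
      stops     : ∀ x y → alive K x ≡ true → alive K y ≡ true →
                  adj (G I) x y ≡ false

  InM : V → V → Set
  InM x y = Σ (Fin K) λ j → (sel j ≡ x × nbr j ≡ y) ⊎ (sel j ≡ y × nbr j ≡ x)

  CoveredM : V → Set
  CoveredM x = Σ (Fin K) λ j → (x ≡ sel j) ⊎ (x ≡ nbr j)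

  InM* : V → V → Set
  InM* x y = mate I x ≡ just y

  IsMatching : (V → Maybe V) → Set
  IsMatching f = ∀ x y → f x ≡ just y → (f y ≡ just x) × (adj (G I) x y ≡ true)

  -- number of covered vertices (= 2 · number of edges)
  coveredCount : (V → Maybe V) → ℕ
  coveredCount f = countV N (λ x → isJ (f x))
    where
      isJ : Maybe V → Bool
      isJ (just _) = true
      isJ _        = false

  IsMaximumMatching : (V → Maybe V) → Set
  IsMaximumMatching f = IsMatching f × (∀ g → IsMatching g → coveredCount g ≤ coveredCount f)

  record OneOnePath : Set where
    field
      a b   : V
      inM   : InM a b
      inM*  : InM* a b

  -- an M-M*-path x_0 x_1 ... x_{2m+1}, m ≥ 1, edges alternately in M*, M,
  -- ..., M*, with distinct nodes and end nodes not covered by M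
  record MMPath : Set where
    field
      m      : ℕ
      m≥1    : 1 ≤ m
      x      : ℕ → V
      inj    : ∀ i j → i < 2 * m + 2 → j < 2 * m + 2 → x i ≡ x j → i ≡ j
      edgeM* : ∀ i → i ≤ m → InM* (x (2 * i)) (x (suc (2 * i)))
      edgeM  : ∀ i → i < m → InM (x (suc (2 * i))) (x (2 * suc i))
      end₀   : ¬ CoveredM (x 0)
      end₁   : ¬ CoveredM (x (suc (2 * m)))

  data Component : Set where
    one-one : OneOnePath → Component
    mm      : MMPath → Component

  NodeOf : Component → V → Set
  NodeOf (one-one p) v = (v ≡ OneOnePath.a p) ⊎ (v ≡ OneOnePath.b p)
  NodeOf (mm p) v = Σ ℕ λ i → (i < 2 * MMPath.m p + 2) × (v ≡ MMPath.x p i)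

  IsOneOne : Component → Set
  IsOneOne (one-one _) = Data.Unit.⊤ where import Data.Unit
  IsOneOne (mm _)      = Data.Empty.⊥ where import Data.Empty

  -- Standing assumption on M*: every component of (V, M ∪ M*) with an edge
  -- is a 1-1-path or an M-M*-path.
  ComponentsOK : Set
  ComponentsOK = ∀ v → CoveredM v ⊎ Is-just (mate I v) → Σ Component λ X → NodeOf X v

  IsPathEnd : V → Set
  IsPathEnd w = Σ MMPath λ p → (w ≡ MMPath.x p 0) ⊎ (w ≡ MMPath.x p (suc (2 * MMPath.m p)))

  -- {v,w} ∈ F, v covered by M (deleted in step s), w endpoint of an
  -- M-M*-path, and d(w) ≤ Δ-2 at the end of step s (i.e. after s+1 steps).
  Transfer : V → V → Set
  Transfer v w =
    (adj (G I) v w ≡ true) × ¬ InM v w × ¬ InM* v w × ¬ InM* w v × IsPathEnd w ×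
    (Σ (Fin K) λ s → ((v ≡ sel s) ⊎ (v ≡ nbr s)) × (deg (suc (toℕ s)) w ≤ Δ I ∸ 2))

  maxDebits : Component → ℕ
  maxDebits (one-one _) = 2 * (Δ I ∸ 1)
  maxDebits (mm p)      = 2 * MMPath.m p * (Δ I ∸ 2)

  -- d_X ≤ maxDebits X - 2 : every duplicate-free list of transfers (v,w)
  -- with v a node of X has length at most maxDebits X - 2.
  TwoMissingDebits : Component → Set
  TwoMissingDebits X =
    (L : List (V × V)) → Unique L →
    All (λ e → NodeOf X (proj₁ e) × Transfer (proj₁ e) (proj₂ e)) L →
    length L ≤ maxDebits X ∸ 2

  EdgeIn : Component → Fin K → Set
  EdgeIn X j = NodeOf X (sel j) × NodeOf X (nbr j)

  -- step j adds the first edge of M lying in X; the creator is sel j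
  CreatedAt : Component → Fin K → Set
  CreatedAt X j = EdgeIn X j × (∀ j′ → toℕ j′ < toℕ j → ¬ EdgeIn X j′)

module Submission where

-- Every node of a component X has degree at most Δ, and its M- and M*-partners are never
-- transfer targets; this gives the maximal number of debits, and the two missing ones come
-- from the step creating X, in which u of degree d is matched with v.  If d ≤ Δ − 2, u has
-- two spare neighbours.  Otherwise take a transfer target w of u or v: as the end of an
-- M-M*-path, w is never deleted; it had degree ≥ d before the step (minimality of d) and has
-- degree ≤ Δ − 2 after it, so it keeps a neighbour and the next selected node s has degree
-- ≤ Δ − 2.  From d ≤ deg s + [s ∼ u] + [s ∼ v], s is adjacent to u or v (to both if d = Δ).
-- Being covered by M, s is not a transfer target, so it is a further non-debit neighbour of
-- u or v, unless s is the M*-partner of u or v; then s lies in X and misses a debit itself,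
-- because its M-partner is one of its at most Δ − 2 neighbours.

open import Data.Bool using (Bool; true; false; not; _∧_; T)
open import Data.Bool.Properties using (T-≡; T-∧; T-∨; not-injective; ¬-not)
import Data.Bool as Bool
open import Data.Empty using (⊥; ⊥-elim)
open import Data.Fin using (Fin; toℕ)
import Data.Fin as Fin
open import Data.Fin.Properties using (toℕ-injective; toℕ-fromℕ<; toℕ<n)
open import Data.List using (List; []; _∷_; length; filterᵇ; allFin; map; _++_)
open import Data.List.Membership.Propositional using (_∈_; lose; find)
open import Data.List.Membership.Propositional.Properties
  using (∈-∃++; ∈-++⁻; ∈-++⁺ˡ; ∈-++⁺ʳ; ∈-allFin; ∈-filter⁺; ∈-filter⁻)
open import Data.List.Properties using (length-++; length-map)
open import Data.List.Relation.Unary.All as All using (All; []; _∷_)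
import Data.List.Relation.Unary.All.Properties as All
open import Data.List.Relation.Unary.All.Properties using (all-filter)
open import Data.List.Relation.Unary.AllPairs using ([]; _∷_)
open import Data.List.Relation.Unary.Any using (here; there; satisfied)
open import Data.List.Relation.Unary.Any.Properties using (any⁺; any⁻)
open import Data.List.Relation.Unary.Unique.Propositional using (Unique)
import Data.List.Relation.Unary.Unique.Propositional.Properties as Unique
open import Data.Nat using (_<ᵇ_; _≟_; ℕ; zero; suc; _+_; _*_; _∸_; _≤_; _<_; z≤n; s≤s; s≤s⁻¹)
open import Data.Nat.Properties
open import Data.Nat.Tactic.RingSolver using (solve-∀)
open import Data.Maybe using (just)
open import Data.Maybe.Properties using (just-injective)
open import Data.Product using (∃; _×_; _,_; proj₁; proj₂)
open import Data.Sum using (_⊎_; inj₁; inj₂)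
import Data.Sum as Sum
open import Function using (_∘_; id; Equivalence)
open import Relation.Binary.PropositionalEquality
open import Relation.Nullary using (¬_; Dec; yes; no)
open import Relation.Nullary.Decidable using (T?)
open import Relation.Binary.Definitions using (tri<; tri≈; tri>)

open import Defs renaming (sym to adj-sym)

indicator : Bool → ℕ
indicator true  = 1
indicator false = 0

indicator≤1 : ∀ b → indicator b ≤ 1
indicator≤1 true  = ≤-refl
indicator≤1 false = z≤n

true≢false : true ≢ false
true≢false ()

T⇒≡true : ∀ {b} → T b → b ≡ true
T⇒≡true = Equivalence.to T-≡

≡true⇒T : ∀ {b} → b ≡ true → T b
≡true⇒T = Equivalence.from T-≡

∧-true⁻ : ∀ {a b} → a ∧ b ≡ true → (a ≡ true) × (b ≡ true)
∧-true⁻ {true} e = refl , e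

∧-true⁺ : ∀ {a b} → a ≡ true → b ≡ true → a ∧ b ≡ true
∧-true⁺ refl refl = refl

==⇒≡ : ∀ {n} {x y : Fin n} → (x == y) ≡ true → x ≡ y
==⇒≡ {x = x} {y} e with x Fin.≟ y
... | yes x≡y = x≡y

≡⇒== : ∀ {n} {x y : Fin n} → x ≡ y → (x == y) ≡ true
≡⇒== {x = x} {y} x≡y with x Fin.≟ y
... | yes _   = refl
... | no x≢y = ⊥-elim (x≢y x≡y)

module _ {A : Set} where

  length-filterᵇ-∷ : (p : A → Bool) (x : A) (xs : List A) →
                     length (filterᵇ p (x ∷ xs)) ≡ indicator (p x) + length (filterᵇ p xs)
  length-filterᵇ-∷ p x xs with p x
  ... | true  = refl
  ... | false = refl

  filterᵇ-mono : (p q : A → Bool) → (∀ x → p x ≡ true → q x ≡ true) →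
                 ∀ xs → length (filterᵇ p xs) ≤ length (filterᵇ q xs)
  filterᵇ-mono p q p⇒q [] = z≤n
  filterᵇ-mono p q p⇒q (x ∷ xs)
    rewrite length-filterᵇ-∷ p x xs | length-filterᵇ-∷ q x xs =
    +-mono-≤ (head (p x) (q x) (p⇒q x)) (filterᵇ-mono p q p⇒q xs)
    where
      head : ∀ a b → (a ≡ true → b ≡ true) → indicator a ≤ indicator b
      head false _     _ = z≤n
      head true  true  _ = ≤-refl
      head true  false h with () ← h refl

  filterᵇ-cover₃ : (p q r s : A → Bool) →
                   (∀ x → p x ≡ true → (q x ≡ true) ⊎ (r x ≡ true) ⊎ (s x ≡ true)) → ∀ xs →
                   length (filterᵇ p xs) ≤
                     length (filterᵇ q xs) + length (filterᵇ r xs) + length (filterᵇ s xs)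
  filterᵇ-cover₃ p q r s cover [] = z≤n
  filterᵇ-cover₃ p q r s cover (x ∷ xs)
    rewrite length-filterᵇ-∷ p x xs | length-filterᵇ-∷ q x xs
          | length-filterᵇ-∷ r x xs | length-filterᵇ-∷ s x xs =
    ≤-trans (+-mono-≤ (head (p x) (q x) (r x) (s x) (cover x)) (filterᵇ-cover₃ p q r s cover xs))
            (≤-reflexive (interchange (indicator (q x)) (indicator (r x)) (indicator (s x)) _ _ _))
    where
      head : ∀ a b c e → (a ≡ true → (b ≡ true) ⊎ (c ≡ true) ⊎ (e ≡ true)) →
             indicator a ≤ indicator b + indicator c + indicator e
      head false _ _ _ _ = z≤n
      head true true _ _ _ = s≤s z≤n
      head true false c e h with h refl
      ... | inj₂ (inj₁ refl) = s≤s z≤n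
      ... | inj₂ (inj₂ refl) = ≤-trans (s≤s z≤n) (≤-reflexive (sym (+-comm (indicator c) 1)))
      interchange : ∀ a b c d e f → a + b + c + (d + e + f) ≡ a + d + (b + e) + (c + f)
      interchange = solve-∀

  unique⊆⇒length≤ : {ws ys : List A} → Unique ws → (∀ {w} → w ∈ ws → w ∈ ys) →
                    length ws ≤ length ys
  unique⊆⇒length≤ {[]} _ _ = z≤n
  unique⊆⇒length≤ {w ∷ ws} {ys} (w∉ws ∷ ws!) ws⊆ys
    with ys₁ , ys₂ , refl ← ∈-∃++ (ws⊆ys (here refl)) =
    ≤-trans (s≤s (unique⊆⇒length≤ ws! ws⊆ys₁++ys₂)) (≤-reflexive (sym length-removed))
    where
      ws⊆ys₁++ys₂ : ∀ {z} → z ∈ ws → z ∈ ys₁ ++ ys₂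
      ws⊆ys₁++ys₂ z∈ws with ∈-++⁻ ys₁ (ws⊆ys (there z∈ws))
      ... | inj₁ z∈ys₁         = ∈-++⁺ˡ z∈ys₁
      ... | inj₂ (here refl)   = ⊥-elim (All.lookup w∉ws z∈ws refl)
      ... | inj₂ (there z∈ys₂) = ∈-++⁺ʳ ys₁ z∈ys₂
      length-removed : length (ys₁ ++ w ∷ ys₂) ≡ suc (length (ys₁ ++ ys₂))
      length-removed = begin
        length (ys₁ ++ w ∷ ys₂)            ≡⟨ length-++ ys₁ ⟩
        length ys₁ + suc (length ys₂)      ≡⟨ +-suc (length ys₁) (length ys₂) ⟩
        suc (length ys₁ + length ys₂)      ≡⟨ cong suc (length-++ ys₁) ⟨
        suc (length (ys₁ ++ ys₂))          ∎
        where open ≡-Reasoning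

map-proj₂-unique : {A B : Set} {a : A} {K : List (A × B)} →
                   All (λ e → proj₁ e ≡ a) K → Unique K → Unique (map proj₂ K)
map-proj₂-unique []           []          = []
map-proj₂-unique (e≡a ∷ K≡a) (e∉K ∷ K!) =
  All.map⁺ (All.map (λ (e′≡a , e≢e′) → e≢e′ ∘ same-fst e≡a e′≡a) (All.zip (K≡a , e∉K)))
  ∷ map-proj₂-unique K≡a K!
  where
    same-fst : ∀ {e e′ a} → proj₁ e ≡ a → proj₁ e′ ≡ a → proj₂ e ≡ proj₂ e′ → e ≡ e′
    same-fst refl refl refl = refl

∈-filterᵇ⁻ : {A : Set} (p : A → Bool) (xs : List A) {y : A} → y ∈ filterᵇ p xs → p y ≡ true
∈-filterᵇ⁻ p xs y∈ = T⇒≡true (proj₂ (∈-filter⁻ (T? ∘ p) {xs = xs} y∈))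

module _ {n : ℕ} where

  filterᵇ-allFin-unique : (p : Fin n → Bool) → Unique (filterᵇ p (allFin n))
  filterᵇ-allFin-unique p = Unique.filter⁺ (T? ∘ p) (Unique.allFin⁺ n)

  count-mono : (p q : Fin n → Bool) → (∀ x → p x ≡ true → q x ≡ true) → countV n p ≤ countV n q
  count-mono p q p⇒q = filterᵇ-mono p q p⇒q (allFin n)

  unique⇒length≤count : (p : Fin n → Bool) {ws : List (Fin n)} → Unique ws →
                        All (λ w → p w ≡ true) ws → length ws ≤ countV n p
  unique⇒length≤count p ws! pws =
    unique⊆⇒length≤ ws! λ {w} w∈ws →
      ∈-filter⁺ (T? ∘ p) (∈-allFin w) (≡true⇒T (All.lookup pws w∈ws))

  count-pos⇒witness : (p : Fin n → Bool) → 0 < countV n p → ∃ λ y → p y ≡ true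
  count-pos⇒witness p pos with filterᵇ p (allFin n) in eq
  ... | y ∷ _ = y , ∈-filterᵇ⁻ p (allFin n) (subst (y ∈_) (sym eq) (here refl))

  ∈-filterᵇ-∧-==⁻ : (q : Fin n → Bool) (u : Fin n) {y : Fin n} →
                    y ∈ filterᵇ (λ z → q z ∧ (z == u)) (allFin n) → (q y ≡ true) × (y ≡ u)
  ∈-filterᵇ-∧-==⁻ q u {y} y∈
    with qy , y==u ← ∧-true⁻ {q y} (∈-filterᵇ⁻ (λ z → q z ∧ (z == u)) (allFin n) y∈) =
    qy , ==⇒≡ y==u

  count-∧-==≤indicator : (q : Fin n → Bool) (u : Fin n) →
                         countV n (λ y → q y ∧ (y == u)) ≤ indicator (q u)
  count-∧-==≤indicator q u with q u in qu
  ... | true  = unique⊆⇒length≤ {ys = u ∷ []} (filterᵇ-allFin-unique (λ y → q y ∧ (y == u)))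
                  λ y∈ → here (proj₂ (∈-filterᵇ-∧-==⁻ q u y∈))
  ... | false = unique⊆⇒length≤ {ys = []} (filterᵇ-allFin-unique (λ y → q y ∧ (y == u))) none
    where
      none : ∀ {y} → y ∈ filterᵇ (λ z → q z ∧ (z == u)) (allFin n) → y ∈ []
      none y∈ with qy , refl ← ∈-filterᵇ-∧-==⁻ q u y∈ = ⊥-elim (true≢false (trans (sym qy) qu))

∑< : ℕ → (ℕ → ℕ) → ℕ
∑< zero    f = 0
∑< (suc N) f = ∑< N f + f N

<-suc⁻ : ∀ {c N} → c < suc N → c ≢ N → c < N
<-suc⁻ c<1+N c≢N = ≤∧≢⇒< (s≤s⁻¹ c<1+N) c≢N

∑<-+ : ∀ N (f g : ℕ → ℕ) → ∑< N (λ c → f c + g c) ≡ ∑< N f + ∑< N g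
∑<-+ zero    f g = refl
∑<-+ (suc N) f g rewrite ∑<-+ N f g = shuffle (∑< N f) (∑< N g) (f N) (g N)
  where
    shuffle : ∀ a b c d → a + b + (c + d) ≡ a + c + (b + d)
    shuffle = solve-∀

∑<-cong : ∀ N {f g : ℕ → ℕ} → (∀ c → c < N → f c ≡ g c) → ∑< N f ≡ ∑< N g
∑<-cong zero    f≗g = refl
∑<-cong (suc N) f≗g = cong₂ _+_ (∑<-cong N λ c c<N → f≗g c (m<n⇒m<1+n c<N)) (f≗g N ≤-refl)

∑<-const : ∀ N B → ∑< N (λ _ → B) ≡ N * B
∑<-const zero    B = refl
∑<-const (suc N) B rewrite ∑<-const N B = +-comm (N * B) B

term≤∑< : ∀ {N c} (f : ℕ → ℕ) → c < N → f c ≤ ∑< N f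
term≤∑< {suc N} {c} f c<1+N with c ≟ N
... | yes refl = m≤n+m (f N) (∑< N f)
... | no c≢N   = ≤-trans (term≤∑< f (<-suc⁻ c<1+N c≢N)) (m≤m+n (∑< N f) (f N))

two-terms≤∑< : ∀ {N c₁ c₂} (f : ℕ → ℕ) → c₁ < N → c₂ < N → c₁ ≢ c₂ → f c₁ + f c₂ ≤ ∑< N f
two-terms≤∑< {suc N} {c₁} {c₂} f c₁<1+N c₂<1+N c₁≢c₂ with c₁ ≟ N | c₂ ≟ N
... | yes refl | yes refl = ⊥-elim (c₁≢c₂ refl)
... | yes refl | no c₂≢N  =
  ≤-trans (≤-reflexive (+-comm (f N) (f c₂))) (+-monoˡ-≤ (f N) (term≤∑< f (<-suc⁻ c₂<1+N c₂≢N)))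
... | no c₁≢N  | yes refl = +-monoˡ-≤ (f N) (term≤∑< f (<-suc⁻ c₁<1+N c₁≢N))
... | no c₁≢N  | no c₂≢N  =
  ≤-trans (two-terms≤∑< f (<-suc⁻ c₁<1+N c₁≢N) (<-suc⁻ c₂<1+N c₂≢N) c₁≢c₂) (m≤m+n (∑< N f) (f N))

∑<+slack : ∀ N B (f : ℕ → ℕ) → (∀ c → c < N → f c ≤ B) →
           ∑< N f + ∑< N (λ c → B ∸ f c) ≡ N * B
∑<+slack N B f f≤B = begin
  ∑< N f + ∑< N (λ c → B ∸ f c)  ≡⟨ ∑<-+ N f (λ c → B ∸ f c) ⟨
  ∑< N (λ c → f c + (B ∸ f c))   ≡⟨ ∑<-cong N (λ c c<N → m+[n∸m]≡n (f≤B c c<N)) ⟩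
  ∑< N (λ _ → B)                 ≡⟨ ∑<-const N B ⟩
  N * B                          ∎
  where open ≡-Reasoning

∑<-slack-one : ∀ N B (f : ℕ → ℕ) {c} → (∀ c → c < N → f c ≤ B) → c < N → 2 + f c ≤ B →
               ∑< N f + 2 ≤ N * B
∑<-slack-one N B f {c} f≤B c<N 2+fc≤B = begin
  ∑< N f + 2                      ≤⟨ +-monoʳ-≤ (∑< N f) (≤-trans (m+n≤o⇒m≤o∸n 2 2+fc≤B)
                                                                  (term≤∑< (λ c → B ∸ f c) c<N)) ⟩
  ∑< N f + ∑< N (λ c → B ∸ f c)   ≡⟨ ∑<+slack N B f f≤B ⟩
  N * B                           ∎
  where open ≤-Reasoning

∑<-slack-two : ∀ N B (f : ℕ → ℕ) {c₁ c₂} → (∀ c → c < N → f c ≤ B) → c₁ < N → c₂ < N → c₁ ≢ c₂ →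
               1 + f c₁ ≤ B → 1 + f c₂ ≤ B → ∑< N f + 2 ≤ N * B
∑<-slack-two N B f f≤B c₁<N c₂<N c₁≢c₂ 1+fc₁≤B 1+fc₂≤B = begin
  ∑< N f + 2                      ≤⟨ +-monoʳ-≤ (∑< N f) (≤-trans two≤slacks
                                                   (two-terms≤∑< (λ c → B ∸ f c) c₁<N c₂<N c₁≢c₂)) ⟩
  ∑< N f + ∑< N (λ c → B ∸ f c)   ≡⟨ ∑<+slack N B f f≤B ⟩
  N * B                           ∎
  where
    open ≤-Reasoning
    two≤slacks : 2 ≤ (B ∸ f _) + (B ∸ f _)
    two≤slacks = +-mono-≤ (m+n≤o⇒m≤o∸n 1 1+fc₁≤B) (m+n≤o⇒m≤o∸n 1 1+fc₂≤B)

module _ {A : Set} where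

  length≤∑<-buckets : (P : ℕ → A → Bool) (N : ℕ) (L : List A) →
                      All (λ a → ∃ λ c → (c < N) × (P c a ≡ true)) L →
                      length L ≤ ∑< N (λ c → length (filterᵇ (P c) L))
  length≤∑<-buckets P N []      _ = z≤n
  length≤∑<-buckets P N (a ∷ L) ((c , c<N , Pca) ∷ bucketed) = begin
    suc (length L)
      ≤⟨ +-mono-≤ a-counted (length≤∑<-buckets P N L bucketed) ⟩
    ∑< N (λ c → indicator (P c a)) + ∑< N (λ c → length (filterᵇ (P c) L))
      ≡⟨ ∑<-+ N _ _ ⟨
    ∑< N (λ c → indicator (P c a) + length (filterᵇ (P c) L))
      ≡⟨ ∑<-cong N (λ c _ → length-filterᵇ-∷ (P c) a L) ⟨
    ∑< N (λ c → length (filterᵇ (P c) (a ∷ L)))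
      ∎
    where
      open ≤-Reasoning
      a-counted : 1 ≤ ∑< N (λ c → indicator (P c a))
      a-counted = ≤-trans (≤-reflexive (cong indicator (sym Pca))) (term≤∑< (λ c → indicator (P c a)) c<N)

private
  rotate : ∀ a x y → a + x + y ≡ x + (y + a)
  rotate = solve-∀

indicators-forced : ∀ {a a′} p q → 2 + a ≤ a′ → a′ ≤ a + indicator p + indicator q →
                    (p ≡ true) × (q ≡ true)
indicators-forced {a} {a′} p q 2+a≤ ≤a+p+q = go p q (≤-trans ≤a+p+q (≤-reflexive (rotate a _ _)))
  where
    go : ∀ p q → a′ ≤ indicator p + (indicator q + a) → (p ≡ true) × (q ≡ true)
    go true  true  _   = refl , refl
    go true  false a′≤ = ⊥-elim (1+n≰n (≤-trans 2+a≤ a′≤))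
    go false true  a′≤ = ⊥-elim (1+n≰n (≤-trans 2+a≤ a′≤))
    go false false a′≤ = ⊥-elim (1+n≰n (≤-trans (m≤n+m _ 1) (≤-trans 2+a≤ a′≤)))

indicator-forced : ∀ {a a′} p q → 1 + a ≤ a′ → a′ ≤ a + indicator p + indicator q →
                   (p ≡ true) ⊎ (q ≡ true)
indicator-forced {a} {a′} p q 1+a≤ ≤a+p+q = go p q (≤-trans ≤a+p+q (≤-reflexive (rotate a _ _)))
  where
    go : ∀ p q → a′ ≤ indicator p + (indicator q + a) → (p ≡ true) ⊎ (q ≡ true)
    go true  _     _   = inj₁ refl
    go false true  _   = inj₂ refl
    go false false a′≤ = ⊥-elim (1+n≰n (≤-trans 1+a≤ a′≤))

m≤n⇒2+m≤n∨1+m≡n∨m≡n : ∀ {d D} → d ≤ D → (2 + d ≤ D) ⊎ (1 + d ≡ D) ⊎ (d ≡ D)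
m≤n⇒2+m≤n∨1+m≡n∨m≡n d≤D with m≤n⇒m<n∨m≡n d≤D
... | inj₂ d≡D = inj₂ (inj₂ d≡D)
... | inj₁ d<D with m≤n⇒m<n∨m≡n d<D
...   | inj₁ 1+d<D = inj₁ 1+d<D
...   | inj₂ 1+d≡D = inj₂ (inj₁ 1+d≡D)

slack-sum : ∀ {a b x y D} → a + x ≤ D → b + y ≤ D → x + y + (a + b) ≤ D + D
slack-sum {a} {b} {x} {y} a+x≤D b+y≤D = ≤-trans (≤-reflexive (shuffle a b x y)) (+-mono-≤ a+x≤D b+y≤D)
  where
    shuffle : ∀ a b x y → x + y + (a + b) ≡ a + x + (b + y)
    shuffle = solve-∀

2+m≤n⇒m≤n∸2 : ∀ {a D} → 2 + a ≤ D → a ≤ D ∸ 2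
2+m≤n⇒m≤n∸2 {a} 2+a≤D = m+n≤o⇒m≤o∸n a (≤-trans (≤-reflexive (+-comm a 2)) 2+a≤D)

halve : ∀ c → ∃ λ i → (c ≡ 2 * i) ⊎ (c ≡ suc (2 * i))
halve zero = 0 , inj₁ refl
halve (suc c) with halve c
... | i , inj₁ refl = i , inj₂ refl
... | i , inj₂ refl = suc i , inj₁ (sym (*-suc 2 i))

pair-cover : {A : Set} {a b u v y : A} → u ≢ v →
             (u ≡ a) ⊎ (u ≡ b) → (v ≡ a) ⊎ (v ≡ b) → (y ≡ a) ⊎ (y ≡ b) → (y ≡ u) ⊎ (y ≡ v)
pair-cover u≢v (inj₁ refl) (inj₁ refl) _ = ⊥-elim (u≢v refl)
pair-cover u≢v (inj₂ refl) (inj₂ refl) _ = ⊥-elim (u≢v refl)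
pair-cover _   (inj₁ refl) (inj₂ refl) y∈ = y∈
pair-cover _   (inj₂ refl) (inj₁ refl) y∈ = Sum.swap y∈

m+4≤n+n⇒m≤2[n∸1]∸2 : ∀ {a D} → 1 ≤ D → a + 4 ≤ D + D → a ≤ 2 * (D ∸ 1) ∸ 2
m+4≤n+n⇒m≤2[n∸1]∸2 {a} {suc D} _ a+4≤ = m+n≤o⇒m≤o∸n a (+-cancelˡ-≤ 2 (a + 2) (2 * D)
  (≤-trans (≤-reflexive (e₁ a)) (≤-trans a+4≤ (≤-reflexive (e₂ D)))))
  where
    e₁ : ∀ a → 2 + (a + 2) ≡ a + 4
    e₁ = solve-∀
    e₂ : ∀ d → suc d + suc d ≡ 2 + 2 * d
    e₂ = solve-∀

-- Runs of the greedy algorithm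

module RunFacts (I : Instance) where

  private
    V = Fin (n I)
    K = k I

  adj-flip : ∀ {a b} → adj (G I) a b ≡ true → adj (G I) b a ≡ true
  adj-flip {a} {b} ab = trans (adj-sym (G I) b a) ab

  adj⇒≢ : ∀ {a b} → adj (G I) a b ≡ true → a ≢ b
  adj⇒≢ {a} ab refl = true≢false (trans (sym ab) (irrefl (G I) a))

  DeletedIn : Fin K → V → Set
  DeletedIn j x = (x ≡ sel I j) ⊎ (x ≡ nbr I j)

  deletedBy⁻ : ∀ t x → deletedBy I t x ≡ true → ∃ λ j → (toℕ j < t) × DeletedIn j x
  deletedBy⁻ t x del
    with j , hit ← satisfied (any⁻ _ (allFin K) (≡true⇒T del))
    with j<t , x∈j ← Equivalence.to (T-∧ {toℕ j <ᵇ t}) hit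
    = j , <ᵇ⇒< (toℕ j) t j<t ,
      Sum.map (==⇒≡ ∘ T⇒≡true) (==⇒≡ ∘ T⇒≡true)
              (Equivalence.to (T-∨ {x == sel I j} {x == nbr I j}) x∈j)

  deletedBy⁺ : ∀ {t x} j → toℕ j < t → DeletedIn j x → deletedBy I t x ≡ true
  deletedBy⁺ {t} {x} j j<t x∈j = T⇒≡true (any⁺ _ (lose (∈-allFin j)
    (Equivalence.from (T-∧ {toℕ j <ᵇ t}) (<⇒<ᵇ j<t ,
      Equivalence.from (T-∨ {x == sel I j} {x == nbr I j})
                       (Sum.map (≡true⇒T ∘ ≡⇒==) (≡true⇒T ∘ ≡⇒==) x∈j)))))

  uncovered-alive : ∀ {w} → ¬ CoveredM I w → ∀ t → alive I t w ≡ true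
  uncovered-alive {w} uncovered t with deletedBy I t w in del
  ... | false = refl
  ... | true with j , _ , w∈j ← deletedBy⁻ t w del = ⊥-elim (uncovered (j , w∈j))

  alive-suc⇒alive : ∀ t y → alive I (suc t) y ≡ true → alive I t y ≡ true
  alive-suc⇒alive t y alive′ with deletedBy I t y in del
  ... | false = refl
  ... | true with j , j<t , y∈j ← deletedBy⁻ t y del
    rewrite deletedBy⁺ {suc t} j (m<n⇒m<1+n j<t) y∈j = ⊥-elim (true≢false (sym alive′))

  dead-after : ∀ {y} j → DeletedIn j y → alive I (suc (toℕ j)) y ≡ false
  dead-after j y∈j = cong not (deletedBy⁺ j ≤-refl y∈j)

  died-at : ∀ {y} j → alive I (toℕ j) y ≡ true → alive I (suc (toℕ j)) y ≡ false → DeletedIn j y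
  died-at {y} j alive-before dead
    with j′ , j′≤j , y∈j′ ← deletedBy⁻ (suc (toℕ j)) y (not-injective dead)
    with m≤n⇒m<n∨m≡n (s≤s⁻¹ j′≤j)
  ... | inj₂ j′≡j rewrite toℕ-injective j′≡j = y∈j′
  ... | inj₁ j′<j =
    ⊥-elim (true≢false (trans (sym alive-before) (cong not (deletedBy⁺ j′ j′<j y∈j′))))

  deg≤degG : ∀ t x → deg I t x ≤ degG (G I) x
  deg≤degG t x = count-mono _ _ (λ y e → proj₁ (∧-true⁻ {adj (G I) x y} e))

  deg-antitone : ∀ t y → deg I (suc t) y ≤ deg I t y
  deg-antitone t y = count-mono _ _ λ z e →
    let yz , z-alive = ∧-true⁻ {adj (G I) y z} e in ∧-true⁺ yz (alive-suc⇒alive t z z-alive)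

  alive-nbrs≤deg : ∀ t x {ws} → Unique ws →
                   All (λ w → (adj (G I) x w ≡ true) × (alive I t w ≡ true)) ws → length ws ≤ deg I t x
  alive-nbrs≤deg t x ws! nbrs =
    unique⇒length≤count _ ws! (All.map (λ (xw , w-alive) → ∧-true⁺ xw w-alive) nbrs)

  nbrs≤degG : ∀ x {ws} → Unique ws → All (λ w → adj (G I) x w ≡ true) ws → length ws ≤ degG (G I) x
  nbrs≤degG x ws! nbrs = unique⇒length≤count _ ws! nbrs

  deg-drop : ∀ j w → deg I (toℕ j) w ≤
             deg I (suc (toℕ j)) w + indicator (adj (G I) w (sel I j)) + indicator (adj (G I) w (nbr I j))
  deg-drop j w = ≤-trans (filterᵇ-cover₃ _ _ _ _ survives-or-deleted (allFin (n I)))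
    (+-mono-≤ (+-monoʳ-≤ (deg I (suc (toℕ j)) w) (count-∧-==≤indicator (adj (G I) w) (sel I j)))
              (count-∧-==≤indicator (adj (G I) w) (nbr I j)))
    where
      survives-or-deleted : ∀ y → adj (G I) w y ∧ alive I (toℕ j) y ≡ true →
        (adj (G I) w y ∧ alive I (suc (toℕ j)) y ≡ true) ⊎
        (adj (G I) w y ∧ (y == sel I j) ≡ true) ⊎ (adj (G I) w y ∧ (y == nbr I j) ≡ true)
      survives-or-deleted y e
        with wy , y-alive ← ∧-true⁻ {adj (G I) w y} e | alive I (suc (toℕ j)) y in alive′
      ... | true  = inj₁ (∧-true⁺ wy refl)
      ... | false with died-at j y-alive alive′
      ...   | inj₁ y≡u = inj₂ (inj₁ (∧-true⁺ wy (≡⇒== y≡u)))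
      ...   | inj₂ y≡v = inj₂ (inj₂ (∧-true⁺ wy (≡⇒== y≡v)))

  module Valid (R : GreedyRun I) where
    open GreedyRun R

    deleted-alive-before : ∀ {x} j → DeletedIn j x → alive I (toℕ j) x ≡ true
    deleted-alive-before j (inj₁ refl) = sel-alive j
    deleted-alive-before j (inj₂ refl) = nbr-alive j

    not-deleted-twice : ∀ {i i′ x} → toℕ i < toℕ i′ → DeletedIn i x → DeletedIn i′ x → ⊥
    not-deleted-twice {i} {i′} i<i′ x∈i x∈i′ =
      true≢false (trans (sym (deleted-alive-before i′ x∈i′)) (cong not (deletedBy⁺ i i<i′ x∈i)))

    InM⇒adj : ∀ {a b} → InM I a b → adj (G I) a b ≡ true
    InM⇒adj (i , inj₁ (refl , refl)) = sel-adj i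
    InM⇒adj (i , inj₂ (refl , refl)) = adj-flip (sel-adj i)

    deleted-once : ∀ {j₁ j₂ x} → DeletedIn j₁ x → DeletedIn j₂ x → j₁ ≡ j₂
    deleted-once {j₁} {j₂} x∈j₁ x∈j₂ with <-cmp (toℕ j₁) (toℕ j₂)
    ... | tri≈ _ j₁≡j₂ _ = toℕ-injective j₁≡j₂
    ... | tri< j₁<j₂ _ _ = ⊥-elim (not-deleted-twice j₁<j₂ x∈j₁ x∈j₂)
    ... | tri> _ _ j₂<j₁ = ⊥-elim (not-deleted-twice j₂<j₁ x∈j₂ x∈j₁)

module TransferFacts (I : Instance) where

  open RunFacts I

  private
    V = Fin (n I)

  transfer-target-uncovered : ∀ {x w} → Transfer I x w → ¬ CoveredM I w
  transfer-target-uncovered (_ , _ , _ , _ , (p , inj₁ refl) , _) = MMPath.end₀ p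
  transfer-target-uncovered (_ , _ , _ , _ , (p , inj₂ refl) , _) = MMPath.end₁ p

  transfer-source-covered : ∀ {x w} → Transfer I x w → CoveredM I x
  transfer-source-covered (_ , _ , _ , _ , _ , s , x∈s , _) = s , x∈s

  module Debits (L : List (V × V)) (L! : Unique L)
                (L-transfers : All (λ e → Transfer I (proj₁ e) (proj₂ e)) L) where

    #transfers : V → ℕ
    #transfers x = length (filterᵇ (λ e → proj₁ e == x) L)

    targets : V → List V
    targets x = map proj₂ (filterᵇ (λ e → proj₁ e == x) L)

    length-targets : ∀ x → length (targets x) ≡ #transfers x
    length-targets x = length-map proj₂ (filterᵇ (λ e → proj₁ e == x) L)

    private
      transfers-from : ∀ x → All (λ e → proj₁ e ≡ x) (filterᵇ (λ e → proj₁ e == x) L)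
      transfers-from x = All.map (==⇒≡ ∘ T⇒≡true) (all-filter (T? ∘ (λ e → proj₁ e == x)) L)

    targets-unique : ∀ x → Unique (targets x)
    targets-unique x = map-proj₂-unique (transfers-from x) (Unique.filter⁺ (T? ∘ _) L!)

    targets-transfers : ∀ x → All (Transfer I x) (targets x)
    targets-transfers x = All.map⁺ (All.map (λ { {a , b} (refl , tr) → tr })
      (All.zip (transfers-from x , All.filter⁺ (T? ∘ _) L-transfers)))

    transfer-witness : ∀ x → 1 ≤ #transfers x → ∃ (Transfer I x)
    transfer-witness x pos with targets x | targets-transfers x | length-targets x
    ... | w ∷ _ | tr ∷ _ | _ = w , tr
    ... | [] | [] | 0≡ = ⊥-elim (1+n≰n (subst (1 ≤_) (sym 0≡) pos))

    length≤∑<-#transfers : (node : ℕ → V) (N : ℕ) →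
                           All (λ e → ∃ λ c → (c < N) × (proj₁ e ≡ node c)) L →
                           length L ≤ ∑< N (λ c → #transfers (node c))
    length≤∑<-#transfers node N bucketed = length≤∑<-buckets (λ c e → proj₁ e == node c) N L
      (All.map (λ (c , c<N , e≡) → c , c<N , ≡⇒== e≡) bucketed)

    private
      non-targets-disjoint : ∀ x {E} → All (λ w → ¬ Transfer I x w) E →
                             ∀ {w} → ¬ ((w ∈ E) × (w ∈ targets x))
      non-targets-disjoint x non-targets (w∈E , w∈targets) =
        All.lookup non-targets w∈E (All.lookup (targets-transfers x) w∈targets)

      length-E++targets : ∀ x E → length (E ++ targets x) ≡ length E + #transfers x
      length-E++targets x E = trans (length-++ E) (cong (length E +_) (length-targets x))

    -- Transfer targets are ends of M-M*-paths, hence never deleted: they stay alive neighbours.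
    nbrs+transfers≤deg : ∀ t x {E} → Unique E → All (λ w → ¬ Transfer I x w) E →
                         All (λ w → (adj (G I) x w ≡ true) × (alive I t w ≡ true)) E →
                         length E + #transfers x ≤ deg I t x
    nbrs+transfers≤deg t x {E} E! non-targets nbrs = subst (_≤ deg I t x) (length-E++targets x E)
      (alive-nbrs≤deg t x (Unique.++⁺ E! (targets-unique x) (non-targets-disjoint x non-targets))
        (All.++⁺ nbrs (All.map (λ tr → proj₁ tr , uncovered-alive (transfer-target-uncovered tr) t)
                               (targets-transfers x))))

    nbrs+transfers≤degG : ∀ x {E} → Unique E → All (λ w → ¬ Transfer I x w) E →
                          All (λ w → adj (G I) x w ≡ true) E → length E + #transfers x ≤ degG (G I) x
    nbrs+transfers≤degG x {E} E! non-targets nbrs = subst (_≤ degG (G I) x) (length-E++targets x E)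
      (nbrs≤degG x (Unique.++⁺ E! (targets-unique x) (non-targets-disjoint x non-targets))
        (All.++⁺ nbrs (All.map proj₁ (targets-transfers x))))

-- The step creating a component

module CreationStep (I : Instance) (R : GreedyRun I) (j : Fin (k I)) where

  open RunFacts I
  open Valid R
  open GreedyRun R
  open TransferFacts I

  private
    V = Fin (n I)

  t : ℕ
  t = toℕ j

  u v : V
  u = sel I j
  v = nbr I j

  d : ℕ
  d = deg I t u

  u≢v : u ≢ v
  u≢v = adj⇒≢ (sel-adj j)

  transfer-target-deg≤ : ∀ {x w} → DeletedIn j x → Transfer I x w → deg I (suc t) w ≤ Δ I ∸ 2
  transfer-target-deg≤ x∈j (_ , _ , _ , _ , _ , s , x∈s , deg≤) rewrite deleted-once x∈s x∈j = deg≤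

  min-degree-bound : ∀ {x w} → DeletedIn j x → alive I t w ≡ true → adj (G I) w x ≡ true →
                     d ≤ deg I (suc t) w + indicator (adj (G I) w u) + indicator (adj (G I) w v)
  min-degree-bound {x} x∈j w-alive wx =
    ≤-trans (sel-min j _ w-alive (alive-nbrs≤deg t _ ([] ∷ []) ((wx , deleted-alive-before j x∈j) ∷ [])))
            (deg-drop j _)

  record NextSelection : Set where
    field
      next   : Fin (k I)
      next≡  : toℕ next ≡ suc t
      deg≤   : deg I (suc t) (sel I next) ≤ Δ I ∸ 2

  next-selection : ∀ w → alive I (suc t) w ≡ true → 1 ≤ deg I (suc t) w → deg I (suc t) w ≤ Δ I ∸ 2 →
                   NextSelection
  next-selection w w-alive w-deg≥1 w-deg≤ with suc t <? k I
  ... | yes 1+t<k = record { next = j′ ; next≡ = j′≡ ; deg≤ = ≤-trans sel≤w w-deg≤ }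
    where
      j′ = Fin.fromℕ< 1+t<k
      j′≡ : toℕ j′ ≡ suc t
      j′≡ = toℕ-fromℕ< 1+t<k
      sel≤w : deg I (suc t) (sel I j′) ≤ deg I (suc t) w
      sel≤w = subst (λ τ → deg I τ (sel I j′) ≤ deg I τ w) j′≡
        (sel-min j′ w (subst (λ τ → alive I τ w ≡ true) (sym j′≡) w-alive)
                      (subst (λ τ → 1 ≤ deg I τ w) (sym j′≡) w-deg≥1))
  ... | no 1+t≮k with y , wy∧y-alive ← count-pos⇒witness _ w-deg≥1 =
    ⊥-elim (true≢false (trans (sym wy) (stops w y (at-end w w-alive) (at-end y y-alive))))
    where
      wy = proj₁ (∧-true⁻ {adj (G I) w y} wy∧y-alive)
      y-alive = proj₂ (∧-true⁻ {adj (G I) w y} wy∧y-alive)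
      at-end : ∀ z → alive I (suc t) z ≡ true → alive I (k I) z ≡ true
      at-end z = subst (λ τ → alive I τ z ≡ true) (≤-antisym (toℕ<n j) (≮⇒≥ 1+t≮k))

  module Selected (N : NextSelection) where
    open NextSelection N

    s s′ : V
    s  = sel I next
    s′ = nbr I next

    s-alive : alive I (suc t) s ≡ true
    s-alive = subst (λ τ → alive I τ s ≡ true) next≡ (sel-alive next)

    s′-alive : alive I (suc t) s′ ≡ true
    s′-alive = subst (λ τ → alive I τ s′ ≡ true) next≡ (nbr-alive next)

    s-covered : CoveredM I s
    s-covered = next , inj₁ refl

    s-matched : InM I s s′
    s-matched = next , inj₁ (refl , refl)

    s≢deleted : ∀ {y} → DeletedIn j y → s ≢ y
    s≢deleted y∈j refl = true≢false (trans (sym s-alive) (dead-after j y∈j))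

    s-deg+2≤Δ : 2 ≤ Δ I → deg I (suc t) s + 2 ≤ Δ I
    s-deg+2≤Δ 2≤Δ = m≤o∸n⇒m+n≤o _ 2≤Δ deg≤

    s-low : d ≤ deg I (suc t) s + indicator (adj (G I) s u) + indicator (adj (G I) s v)
    s-low = ≤-trans (sel-min j s (alive-suc⇒alive t s s-alive) s-deg≥1) (deg-drop j s)
      where
        s-deg≥1 : 1 ≤ deg I t s
        s-deg≥1 = ≤-trans (alive-nbrs≤deg (suc t) s ([] ∷ []) ((sel-adj next , s′-alive) ∷ []))
                          (deg-antitone t s)

    adjacent-both : 2 ≤ Δ I → d ≡ Δ I → (adj (G I) s u ≡ true) × (adj (G I) s v ≡ true)
    adjacent-both 2≤Δ d≡Δ = indicators-forced _ _
      (≤-trans (≤-reflexive (+-comm 2 _)) (≤-trans (s-deg+2≤Δ 2≤Δ) (≤-reflexive (sym d≡Δ)))) s-low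

    adjacent-deleted : (adj (G I) s u ≡ true) × (adj (G I) s v ≡ true) →
                             ∀ {x} → DeletedIn j x → adj (G I) s x ≡ true
    adjacent-deleted (su , _) (inj₁ refl) = su
    adjacent-deleted (_ , sv) (inj₂ refl) = sv

    adjacent-either : 2 ≤ Δ I → suc d ≡ Δ I → (adj (G I) s u ≡ true) ⊎ (adj (G I) s v ≡ true)
    adjacent-either 2≤Δ 1+d≡Δ = indicator-forced _ _
      (s≤s⁻¹ (≤-trans (≤-reflexive (+-comm 2 _)) (≤-trans (s-deg+2≤Δ 2≤Δ) (≤-reflexive (sym 1+d≡Δ)))))
      s-low

  next-after-transfer : ∀ {x w} → DeletedIn j x → Transfer I x w → 1 ≤ deg I (suc t) w → NextSelection
  next-after-transfer x∈j tr w-deg≥1 =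
    next-selection _ (uncovered-alive (transfer-target-uncovered tr) (suc t)) w-deg≥1
                     (transfer-target-deg≤ x∈j tr)

  transfer-target-deg≥ : ∀ {x w} → DeletedIn j x → Transfer I x w → d ≤ deg I (suc t) w + 2
  transfer-target-deg≥ {w = w} x∈j tr = ≤-trans
    (min-degree-bound x∈j (uncovered-alive (transfer-target-uncovered tr) t) (adj-flip (proj₁ tr)))
    (≤-trans (+-mono-≤ (+-monoʳ-≤ (deg I (suc t) w) (indicator≤1 _)) (indicator≤1 _))
             (≤-reflexive (+-assoc (deg I (suc t) w) 1 1)))

  next-after-transfer-3≤d : ∀ {x w} → DeletedIn j x → Transfer I x w → 3 ≤ d → NextSelection
  next-after-transfer-3≤d {w = w} x∈j tr 3≤d =
    next-after-transfer x∈j tr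
      (+-cancelʳ-≤ 2 1 (deg I (suc t) w) (≤-trans 3≤d (transfer-target-deg≥ x∈j tr)))

module DebitsAtCreation (I : Instance) (3≤Δ : 3 ≤ Δ I) (max-deg : MaxDegree≤ (G I) (Δ I))
                (R : GreedyRun I) (j : Fin (k I)) (L : List (Fin (n I) × Fin (n I))) (L! : Unique L)
                (L-transfers : All (λ e → Transfer I (proj₁ e) (proj₂ e)) L) where

  open RunFacts I
  open Valid R
  open GreedyRun R
  open TransferFacts I
  open Debits L L! L-transfers public
  open CreationStep I R j public

  private
    V = Fin (n I)

  2≤Δ : 2 ≤ Δ I
  2≤Δ = ≤-trans (n≤1+n 2) 3≤Δ

  d≤Δ : d ≤ Δ I
  d≤Δ = ≤-trans (deg≤degG t u) (max-deg u)

  u-in-j : DeletedIn j u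
  u-in-j = inj₁ refl

  v-in-j : DeletedIn j v
  v-in-j = inj₂ refl

  matched-no-transfer : ∀ {x y} → InM I x y → ¬ Transfer I x y
  matched-no-transfer xy (_ , x≁My , _) = x≁My xy

  no-transfer-to-covered : ∀ {x y} → CoveredM I y → ¬ Transfer I x y
  no-transfer-to-covered y-covered tr = transfer-target-uncovered tr y-covered

  ¬u→v : ¬ Transfer I u v
  ¬u→v = matched-no-transfer (j , inj₁ (refl , refl))

  ¬v→u : ¬ Transfer I v u
  ¬v→u = matched-no-transfer (j , inj₂ (refl , refl))

  v-adj-u : adj (G I) v u ≡ true
  v-adj-u = adj-flip (sel-adj j)

  none-or-transfer : ∀ x → (#transfers x ≡ 0) ⊎ ∃ (Transfer I x)
  none-or-transfer x with #transfers x in #x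
  ... | zero  = inj₁ refl
  ... | suc _ = inj₂ (transfer-witness x (≤-trans (s≤s z≤n) (≤-reflexive (sym #x))))

  no-transfers-slack : ∀ {x} k → k ≤ Δ I → #transfers x ≡ 0 → k + #transfers x ≤ Δ I
  no-transfers-slack k k≤Δ #x≡0 rewrite #x≡0 | +-identityʳ k = k≤Δ

  saturated⇒3≤d : d ≡ Δ I → 3 ≤ d
  saturated⇒3≤d d≡Δ = ≤-trans 3≤Δ (≤-reflexive (sym d≡Δ))

  next-debits : (N : NextSelection) → 3 + #transfers (Selected.s N) ≤ Δ I
  next-debits N = ≤-trans (≤-reflexive (+-comm 2 (1 + #transfers s)))
    (≤-trans (+-monoˡ-≤ 2 s-base) (s-deg+2≤Δ 2≤Δ))
    where
      open NextSelection N
      open Selected N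
      s-base : 1 + #transfers s ≤ deg I (suc t) s
      s-base = nbrs+transfers≤deg (suc t) s ([] ∷ []) (matched-no-transfer s-matched ∷ [])
                                  ((sel-adj next , s′-alive) ∷ [])

  module OneOne where

    u-base : 1 + #transfers u ≤ d
    u-base = nbrs+transfers≤deg t u ([] ∷ []) (¬u→v ∷ []) ((sel-adj j , nbr-alive j) ∷ [])

    v-base : 1 + #transfers v ≤ Δ I
    v-base = ≤-trans (nbrs+transfers≤degG v ([] ∷ []) (¬v→u ∷ []) (v-adj-u ∷ [])) (max-deg v)

    saturated : d ≡ Δ I → ∀ {x y} → DeletedIn j x → DeletedIn j y →
                adj (G I) x y ≡ true → ¬ Transfer I x y → 2 + #transfers x ≤ Δ I
    saturated d≡Δ {x} {y} x∈j y∈j xy ¬x→y with none-or-transfer x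
    ... | inj₁ #x≡0 = no-transfers-slack 2 2≤Δ #x≡0
    ... | inj₂ (w , x→w) = ≤-trans
      (nbrs+transfers≤degG x (((λ y≡s → s≢deleted y∈j (sym y≡s)) ∷ []) ∷ [] ∷ [])
        (¬x→y ∷ no-transfer-to-covered s-covered ∷ [])
        (xy ∷ adj-flip (adjacent-deleted (adjacent-both 2≤Δ d≡Δ) x∈j) ∷ []))
      (max-deg x)
      where
        open Selected (next-after-transfer-3≤d x∈j x→w (saturated⇒3≤d d≡Δ))

    via-target-off-u : 1 + d ≡ Δ I → ∀ {w} → Transfer I v w → adj (G I) w u ≡ false →
                       (3 + #transfers u ≤ Δ I) ⊎ (2 + #transfers v ≤ Δ I)
    via-target-off-u 1+d≡Δ {w} v→w wu≡false = from-next (next-after-transfer v-in-j v→w w-deg≥1)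
      where
        d≤w+1 : d ≤ deg I (suc t) w + 1
        d≤w+1 = ≤-trans
          (min-degree-bound v-in-j (uncovered-alive (transfer-target-uncovered v→w) t)
                                   (adj-flip (proj₁ v→w)))
          (+-mono-≤ (≤-reflexive (trans (cong (λ b → deg I (suc t) w + indicator b) wu≡false)
                                        (+-identityʳ _)))
                    (indicator≤1 _))
        w-deg≥1 : 1 ≤ deg I (suc t) w
        w-deg≥1 = +-cancelʳ-≤ 1 1 _ (≤-trans (s≤s⁻¹ (≤-trans 3≤Δ (≤-reflexive (sym 1+d≡Δ)))) d≤w+1)
        from-next : NextSelection → (3 + #transfers u ≤ Δ I) ⊎ (2 + #transfers v ≤ Δ I)
        from-next N with Selected.adjacent-either N 2≤Δ 1+d≡Δ
        ... | inj₁ su = inj₁ (≤-trans (s≤s u-nbrs) (≤-reflexive 1+d≡Δ))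
          where
            open Selected N
            u-nbrs : 2 + #transfers u ≤ d
            u-nbrs = nbrs+transfers≤deg t u (((λ v≡s → s≢deleted v-in-j (sym v≡s)) ∷ []) ∷ [] ∷ [])
              (¬u→v ∷ no-transfer-to-covered s-covered ∷ [])
              ((sel-adj j , nbr-alive j) ∷ (adj-flip su , alive-suc⇒alive t s s-alive) ∷ [])
        ... | inj₂ sv = inj₂ (≤-trans
          (nbrs+transfers≤degG v (((λ u≡s → s≢deleted u-in-j (sym u≡s)) ∷ []) ∷ [] ∷ [])
            (¬v→u ∷ no-transfer-to-covered s-covered ∷ []) (v-adj-u ∷ adj-flip sv ∷ []))
          (max-deg v))
          where open Selected N

    adj-u? : ∀ w → Dec (adj (G I) u w ≡ true)
    adj-u? w = adj (G I) u w Bool.≟ true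

    -- If all debit targets of v are adjacent to u, they are further alive neighbours of u;
    -- otherwise a target off u loses at most one degree in step j, so d ≥ 2 suffices.
    v-slack : 1 + d ≡ Δ I → (3 + #transfers u ≤ Δ I) ⊎ (2 + #transfers v ≤ Δ I)
    v-slack 1+d≡Δ with All.all? adj-u? (targets v)
    ... | yes targets-adj-u = inj₂ (≤-trans (s≤s v+targets≤d) (≤-reflexive 1+d≡Δ))
      where
        v∉targets : All (v ≢_) (targets v)
        v∉targets = All.map (λ tr → adj⇒≢ (proj₁ tr)) (targets-transfers v)
        v+targets≤d : 1 + #transfers v ≤ d
        v+targets≤d = subst (λ m → 1 + m ≤ d) (length-targets v)
          (alive-nbrs≤deg t u (v∉targets ∷ targets-unique v) ((sel-adj j , nbr-alive j) ∷
            All.map (λ (uw , tr) → uw , uncovered-alive (transfer-target-uncovered tr) t)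
                    (All.zip (targets-adj-u , targets-transfers v))))
    ... | no ¬targets-adj-u
      with w , w∈targets , ¬uw ← find (All.¬All⇒Any¬ adj-u? (targets v) ¬targets-adj-u) =
      via-target-off-u 1+d≡Δ (All.lookup (targets-transfers v) w∈targets)
                             (trans (adj-sym (G I) w u) (¬-not ¬uw))

    debit-bound : #transfers u + #transfers v + 4 ≤ Δ I + Δ I
    debit-bound with m≤n⇒2+m≤n∨1+m≡n∨m≡n d≤Δ
    ... | inj₁ 2+d≤Δ        = slack-sum {3} {1} (≤-trans (s≤s (s≤s u-base)) 2+d≤Δ) v-base
    ... | inj₂ (inj₂ d≡Δ)   = slack-sum {2} {2} (saturated d≡Δ u-in-j v-in-j (sel-adj j) ¬u→v)
                                                (saturated d≡Δ v-in-j u-in-j v-adj-u ¬v→u)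
    ... | inj₂ (inj₁ 1+d≡Δ) with v-slack 1+d≡Δ
    ...   | inj₁ 3+u≤Δ = slack-sum {3} {1} 3+u≤Δ v-base
    ...   | inj₂ 2+v≤Δ = slack-sum {2} {2} (≤-trans (s≤s u-base) (≤-reflexive 1+d≡Δ)) 2+v≤Δ

  module MM (is-matching : IsMatching I (mate I)) (Inner : V → Set) (inner-u : Inner u) (inner-v : Inner v)
            {us vs : V} (u-mate : InM* I u us) (v-mate : InM* I v vs)
            (us≢v : us ≢ v) (vs≢u : vs ≢ u) (us≢vs : us ≢ vs) (us-alive : alive I t us ≡ true)
            (inner-us : CoveredM I us → Inner us) (inner-vs : CoveredM I vs → Inner vs) where

    data TwoMissing : Set where
      one-node  : ∀ {x} → Inner x → 4 + #transfers x ≤ Δ I → TwoMissing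
      two-nodes : ∀ {x y} → Inner x → Inner y → x ≢ y →
                  3 + #transfers x ≤ Δ I → 3 + #transfers y ≤ Δ I → TwoMissing

    u-us : adj (G I) u us ≡ true
    u-us = proj₂ (is-matching u us u-mate)

    v-vs : adj (G I) v vs ≡ true
    v-vs = proj₂ (is-matching v vs v-mate)

    ¬u→us : ¬ Transfer I u us
    ¬u→us (_ , _ , ¬u-us , _) = ¬u-us u-mate

    ¬v→vs : ¬ Transfer I v vs
    ¬v→vs (_ , _ , ¬v-vs , _) = ¬v-vs v-mate

    u-base : 2 + #transfers u ≤ d
    u-base = nbrs+transfers≤deg t u (((us≢v ∘ sym) ∷ []) ∷ [] ∷ []) (¬u→v ∷ ¬u→us ∷ [])
      ((sel-adj j , nbr-alive j) ∷ (u-us , us-alive) ∷ [])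

    v-base : 2 + #transfers v ≤ Δ I
    v-base = ≤-trans
      (nbrs+transfers≤degG v (((vs≢u ∘ sym) ∷ []) ∷ [] ∷ []) (¬v→u ∷ ¬v→vs ∷ []) (v-adj-u ∷ v-vs ∷ []))
      (max-deg v)

    module ThirdNeighbour (N : NextSelection) where
      open Selected N

      u-third : adj (G I) s u ≡ true → s ≢ us → 3 + #transfers u ≤ d
      u-third su s≢us = nbrs+transfers≤deg t u
        (((us≢v ∘ sym) ∷ (s≢deleted v-in-j ∘ sym) ∷ []) ∷ ((s≢us ∘ sym) ∷ []) ∷ [] ∷ [])
        (¬u→v ∷ ¬u→us ∷ no-transfer-to-covered s-covered ∷ [])
        ((sel-adj j , nbr-alive j) ∷ (u-us , us-alive)
          ∷ (adj-flip su , alive-suc⇒alive t s s-alive) ∷ [])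

      v-third : adj (G I) s v ≡ true → s ≢ vs → 3 + #transfers v ≤ Δ I
      v-third sv s≢vs = ≤-trans (nbrs+transfers≤degG v
        (((vs≢u ∘ sym) ∷ (s≢deleted u-in-j ∘ sym) ∷ []) ∷ ((s≢vs ∘ sym) ∷ []) ∷ [] ∷ [])
        (¬v→u ∷ ¬v→vs ∷ no-transfer-to-covered s-covered ∷ [])
        (v-adj-u ∷ v-vs ∷ adj-flip sv ∷ [])) (max-deg v)

      next-slack : ∀ {x} → s ≡ x → 3 + #transfers x ≤ Δ I
      next-slack refl = next-debits N

      next-covered : ∀ {x} → s ≡ x → CoveredM I x
      next-covered refl = s-covered

    saturated-v : d ≡ Δ I → 3 + #transfers u ≤ Δ I → TwoMissing
    saturated-v d≡Δ u-slack with none-or-transfer v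
    ... | inj₁ #v≡0 = two-nodes inner-u inner-v u≢v u-slack (no-transfers-slack 3 3≤Δ #v≡0)
    ... | inj₂ (w , v→w) = from-next (next-after-transfer-3≤d v-in-j v→w (saturated⇒3≤d d≡Δ))
      where
        from-next : NextSelection → TwoMissing
        from-next N with Selected.s N Fin.≟ vs
        ... | yes s≡vs =
          two-nodes inner-u (inner-vs (next-covered s≡vs)) (vs≢u ∘ sym) u-slack (next-slack s≡vs)
          where open ThirdNeighbour N
        ... | no s≢vs = two-nodes inner-u inner-v u≢v u-slack
                          (v-third (proj₂ (adjacent-both 2≤Δ d≡Δ)) s≢vs)
          where open ThirdNeighbour N
                open Selected N

    saturated : d ≡ Δ I → TwoMissing
    saturated d≡Δ with none-or-transfer u
    ... | inj₁ #u≡0 = saturated-v d≡Δ (no-transfers-slack 3 3≤Δ #u≡0)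
    ... | inj₂ (w , u→w) = from-next (next-after-transfer-3≤d u-in-j u→w (saturated⇒3≤d d≡Δ))
      where
        from-next : NextSelection → TwoMissing
        from-next N with Selected.s N Fin.≟ us | Selected.adjacent-both N 2≤Δ d≡Δ
        ... | yes s≡us | _ , sv = two-nodes inner-v (inner-us (next-covered s≡us)) (us≢v ∘ sym)
                                    (v-third sv (λ s≡vs → us≢vs (trans (sym s≡us) s≡vs))) (next-slack s≡us)
          where open ThirdNeighbour N
        ... | no s≢us  | su , _ = saturated-v d≡Δ (≤-trans (u-third su s≢us) (≤-reflexive d≡Δ))
          where open ThirdNeighbour N

    almost-saturated : 1 + d ≡ Δ I → 4 ≤ Δ I → TwoMissing
    almost-saturated 1+d≡Δ 4≤Δ with none-or-transfer v
    ... | inj₁ #v≡0 = two-nodes inner-u inner-v u≢v u-slack (no-transfers-slack 3 3≤Δ #v≡0)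
      where u-slack = ≤-trans (s≤s u-base) (≤-reflexive 1+d≡Δ)
    ... | inj₂ (w , v→w) =
      from-next (next-after-transfer-3≤d v-in-j v→w (s≤s⁻¹ (≤-trans 4≤Δ (≤-reflexive (sym 1+d≡Δ)))))
      where
        u-slack : 3 + #transfers u ≤ Δ I
        u-slack = ≤-trans (s≤s u-base) (≤-reflexive 1+d≡Δ)
        from-next : NextSelection → TwoMissing
        from-next N with Selected.adjacent-either N 2≤Δ 1+d≡Δ
        ... | inj₁ su with Selected.s N Fin.≟ us
        ...   | yes s≡us =
          two-nodes inner-u (inner-us (next-covered s≡us)) (adj⇒≢ u-us) u-slack (next-slack s≡us)
          where open ThirdNeighbour N
        ...   | no s≢us  = one-node inner-u (≤-trans (s≤s (u-third su s≢us)) (≤-reflexive 1+d≡Δ))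
          where open ThirdNeighbour N
        from-next N | inj₂ sv with Selected.s N Fin.≟ vs
        ...   | yes s≡vs =
          two-nodes inner-u (inner-vs (next-covered s≡vs)) (vs≢u ∘ sym) u-slack (next-slack s≡vs)
          where open ThirdNeighbour N
        ...   | no s≢vs  = two-nodes inner-u inner-v u≢v u-slack (v-third sv s≢vs)
          where open ThirdNeighbour N

    unsaturated : 2 + d ≤ Δ I → TwoMissing
    unsaturated 2+d≤Δ = one-node inner-u (≤-trans (s≤s (s≤s u-base)) 2+d≤Δ)

    two-missing : (d ≤ Δ I ∸ 2) ⊎ (d ≡ Δ I) ⊎ (4 ≤ Δ I) → TwoMissing
    two-missing (inj₁ d≤Δ-2)      =
      unsaturated (≤-trans (≤-reflexive (+-comm 2 d)) (m≤o∸n⇒m+n≤o d 2≤Δ d≤Δ-2))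
    two-missing (inj₂ (inj₁ d≡Δ)) = saturated d≡Δ
    two-missing (inj₂ (inj₂ 4≤Δ)) with m≤n⇒2+m≤n∨1+m≡n∨m≡n d≤Δ
    ... | inj₁ 2+d≤Δ        = unsaturated 2+d≤Δ
    ... | inj₂ (inj₁ 1+d≡Δ) = almost-saturated 1+d≡Δ 4≤Δ
    ... | inj₂ (inj₂ d≡Δ)   = saturated d≡Δ

-- M-M*-paths

module PathFacts (I : Instance) (is-matching : IsMatching I (mate I)) (p : MMPath I) where

  open MMPath p
  open RunFacts I

  private
    V = Fin (n I)

  length-as-suc : 2 * m + 2 ≡ suc (suc (2 * m))
  length-as-suc = +-comm (2 * m) 2

  inner<length : ∀ {c} → c < 2 * m → suc c < 2 * m + 2
  inner<length c<2m = ≤-trans (s≤s (m≤n⇒m≤1+n c<2m)) (≤-reflexive (sym length-as-suc))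

  covered⇒inner : ∀ {c} → c < 2 * m + 2 → CoveredM I (x c) →
                  ∃ λ c′ → (c ≡ suc c′) × (c′ < 2 * m)
  covered⇒inner {zero}   _          covered = ⊥-elim (end₀ covered)
  covered⇒inner {suc c′} c<2m+2 covered with c′ ≟ 2 * m
  ... | yes refl = ⊥-elim (end₁ covered)
  ... | no c′≢2m =
    c′ , refl , ≤∧≢⇒< (s≤s⁻¹ (s≤s⁻¹ (≤-trans c<2m+2 (≤-reflexive length-as-suc)))) c′≢2m

  InM-sym : ∀ {a b} → InM I a b → InM I b a
  InM-sym (i , inj₁ (e₁ , e₂)) = i , inj₂ (e₁ , e₂)
  InM-sym (i , inj₂ (e₁ , e₂)) = i , inj₁ (e₁ , e₂)

  record InnerNode (y : V) : Set where
    field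
      mate-idx partner-idx : ℕ
      mate-idx<    : mate-idx < 2 * m + 2
      partner-idx< : partner-idx < 2 * m + 2
      mate≢partner : mate-idx ≢ partner-idx
      mated        : InM* I y (x mate-idx)
      matched      : InM I y (x partner-idx)

  -- x (2i) x (2i+1) are M*-edges and x (2i+1) x (2i+2) are M-edges.
  inner-node : ∀ c′ → c′ < 2 * m → InnerNode (x (suc c′))
  inner-node c′ c′<2m with halve c′
  ... | i , inj₁ refl = record
    { mate-idx = 2 * i ; partner-idx = 2 * suc i
    ; mate-idx< = ≤-trans (n≤1+n _) (inner<length c′<2m)
    ; partner-idx< = ≤-trans (s≤s (*-monoʳ-≤ 2 i<m))
                             (≤-trans (n≤1+n _) (≤-reflexive (sym length-as-suc)))
    ; mate≢partner = λ 2i≡2+2i → 1+n≢n (sym (*-cancelˡ-≡ i (suc i) 2 2i≡2+2i))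
    ; mated = proj₁ (is-matching _ _ (edgeM* i (<⇒≤ i<m)))
    ; matched = edgeM i i<m }
    where
      i<m : i < m
      i<m = *-cancelˡ-< 2 _ _ c′<2m
  ... | i , inj₂ refl = record
    { mate-idx = suc (2 * suc i) ; partner-idx = suc (2 * i)
    ; mate-idx< = subst (λ z → suc z < 2 * m + 2) (sym 2*suc)
                        (≤-trans (s≤s (s≤s c′<2m)) (≤-reflexive (sym length-as-suc)))
    ; partner-idx< = ≤-trans (n≤1+n _) (inner<length c′<2m)
    ; mate≢partner = λ e → <⇒≢ (n≤1+n _) (sym (trans (cong suc (sym 2*suc)) e))
    ; mated = subst (λ z → InM* I (x z) (x (suc (2 * suc i)))) 2*suc (edgeM* (suc i) i<m)
    ; matched = subst (λ z → InM I (x z) (x (suc (2 * i)))) 2*suc (InM-sym (edgeM i i<m)) }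
    where
      2*suc : 2 * suc i ≡ suc (suc (2 * i))
      2*suc = *-suc 2 i
      i<m : i < m
      i<m = *-cancelˡ-< 2 _ _ (<⇒≤ c′<2m)

  node : ∀ {c} → c < 2 * m + 2 → NodeOf I (mm p) (x c)
  node c< = _ , c< , refl

  IsInner : V → Set
  IsInner y = ∃ λ c → (c < 2 * m) × (y ≡ x (suc c))

  covered-node⇒inner : ∀ {y} → NodeOf I (mm p) y → CoveredM I y → IsInner y
  covered-node⇒inner (c , c< , refl) covered
    with c′ , refl , c′<2m ← covered⇒inner c< covered = c′ , c′<2m , refl

  inner-node-of : ∀ {y} → IsInner y → InnerNode y
  inner-node-of (c , c<2m , refl) = inner-node c c<2m

  module _ (R : GreedyRun I) where
    open Valid R

    step-partner : ∀ {y z j′} (Y : InnerNode y) → DeletedIn j′ y → DeletedIn j′ z →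
                   (z ≡ y) ⊎ (z ≡ x (InnerNode.partner-idx Y))
    step-partner Y y∈j′ z∈j′ with InnerNode.matched Y
    ... | jM , inj₁ (sel≡y , nbr≡p) with refl ← deleted-once (inj₁ (sym sel≡y)) y∈j′ =
      Sum.map (λ z≡sel → trans z≡sel sel≡y) (λ z≡nbr → trans z≡nbr nbr≡p) z∈j′
    ... | jM , inj₂ (sel≡p , nbr≡y) with refl ← deleted-once (inj₂ (sym nbr≡y)) y∈j′ =
      Sum.swap (Sum.map (λ z≡sel → trans z≡sel sel≡p) (λ z≡nbr → trans z≡nbr nbr≡y) z∈j′)

    step-within-path : ∀ {c j′} → c < 2 * m + 2 → DeletedIn j′ (x c) → EdgeIn I (mm p) j′
    step-within-path {c} c< xc∈j′ with c′ , refl , c′<2m ← covered⇒inner c< (_ , xc∈j′) =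
      in-path (step-partner Y xc∈j′ (inj₁ refl)) , in-path (step-partner Y xc∈j′ (inj₂ refl))
      where
        Y = inner-node c′ c′<2m
        in-path : ∀ {z} → (z ≡ x c) ⊎ (z ≡ x (InnerNode.partner-idx Y)) → NodeOf I (mm p) z
        in-path (inj₁ refl) = node c<
        in-path (inj₂ refl) = node (InnerNode.partner-idx< Y)

one-one-debits : (I : Instance) → 3 ≤ Δ I → MaxDegree≤ (G I) (Δ I) → GreedyRun I →
                 (P : OneOnePath I) (j : Fin (k I)) → CreatedAt I (one-one P) j →
                 TwoMissingDebits I (one-one P)
one-one-debits I 3≤Δ max-deg R P j ((u∈P , v∈P) , _) L L! L-all =
  ≤-trans (length≤∑<-#transfers endpoint 2 (All.map (λ (y∈P , _) → endpoint-of y∈P) L-all))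
          (m+4≤n+n⇒m≤2[n∸1]∸2 (≤-trans (s≤s z≤n) 3≤Δ) OneOne.debit-bound)
  where
    open DebitsAtCreation I 3≤Δ max-deg R j L L! (All.map proj₂ L-all)
    endpoint : ℕ → Fin (n I)
    endpoint zero    = u
    endpoint (suc _) = v
    endpoint-of : ∀ {y} → NodeOf I (one-one P) y → ∃ λ c → (c < 2) × (y ≡ endpoint c)
    endpoint-of y∈P with pair-cover u≢v u∈P v∈P y∈P
    ... | inj₁ y≡u = 0 , s≤s z≤n , y≡u
    ... | inj₂ y≡v = 1 , s≤s (s≤s z≤n) , y≡v

module MMComponent (I : Instance) (3≤Δ : 3 ≤ Δ I) (max-deg : MaxDegree≤ (G I) (Δ I))
                   (R : GreedyRun I) (is-matching : IsMatching I (mate I))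
                   (P : MMPath I) (j : Fin (k I)) (created : CreatedAt I (mm P) j)
                   (L : List (Fin (n I) × Fin (n I))) (L! : Unique L)
                   (L-in-P : All (λ e → NodeOf I (mm P) (proj₁ e) × Transfer I (proj₁ e) (proj₂ e)) L)
                   where

  open MMPath P
  open RunFacts I
  open Valid R
  open TransferFacts I
  open PathFacts I is-matching P
  open DebitsAtCreation I 3≤Δ max-deg R j L L! (All.map proj₂ L-in-P)
  open InnerNode

  u-inner : IsInner u
  u-inner = covered-node⇒inner (proj₁ (proj₁ created)) (j , u-in-j)

  v-inner : IsInner v
  v-inner = covered-node⇒inner (proj₂ (proj₁ created)) (j , v-in-j)

  U V′ : InnerNode _
  U  = inner-node-of u-inner
  V′ = inner-node-of v-inner

  mate≢step-partner : ∀ {y z} (Y : InnerNode y) → DeletedIn j y → DeletedIn j z → y ≢ z →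
                      x (mate-idx Y) ≢ z
  mate≢step-partner Y y∈j z∈j y≢z mate≡z with step-partner R Y y∈j z∈j
  ... | inj₁ z≡y = y≢z (sym z≡y)
  ... | inj₂ z≡p = mate≢partner Y (inj _ _ (mate-idx< Y) (partner-idx< Y) (trans mate≡z z≡p))

  us≢vs : x (mate-idx U) ≢ x (mate-idx V′)
  us≢vs us≡vs = u≢v (just-injective (trans (sym (proj₁ (is-matching _ _ (mated U))))
    (subst (λ z → mate I z ≡ just v) (sym us≡vs) (proj₁ (is-matching _ _ (mated V′))))))

  -- An earlier deletion of u's M*-partner would have added an edge of X before step j.
  us-alive : alive I t (x (mate-idx U)) ≡ true
  us-alive with deletedBy I t (x (mate-idx U)) in del
  ... | false = refl
  ... | true with j′ , j′<j , us∈j′ ← deletedBy⁻ t _ del =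
    ⊥-elim (proj₂ created j′ j′<j (step-within-path R (mate-idx< U) us∈j′))

  open MM is-matching IsInner u-inner v-inner (mated U) (mated V′)
          (mate≢step-partner U u-in-j v-in-j u≢v) (mate≢step-partner V′ v-in-j u-in-j (u≢v ∘ sym))
          us≢vs us-alive
          (covered-node⇒inner (node (mate-idx< U))) (covered-node⇒inner (node (mate-idx< V′)))

  inner-debits : ∀ {y} → InnerNode y → 2 + #transfers y ≤ Δ I
  inner-debits Y = ≤-trans (nbrs+transfers≤degG _
    (((λ p≡m → mate≢partner Y (sym (inj _ _ (partner-idx< Y) (mate-idx< Y) p≡m))) ∷ []) ∷ [] ∷ [])
    (matched-no-transfer (matched Y) ∷ (λ (_ , _ , ¬mated , _) → ¬mated (mated Y)) ∷ [])
    (InM⇒adj (matched Y) ∷ proj₂ (is-matching _ _ (mated Y)) ∷ [])) (max-deg _)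

  inner-debits≤ : ∀ c → c < 2 * m → #transfers (x (suc c)) ≤ Δ I ∸ 2
  inner-debits≤ c c<2m = 2+m≤n⇒m≤n∸2 (inner-debits (inner-node c c<2m))

  debit-bound : TwoMissing → ∑< (2 * m) (λ c → #transfers (x (suc c))) + 2 ≤ 2 * m * (Δ I ∸ 2)
  debit-bound (one-node (c , c<2m , refl) 4+≤Δ) =
    ∑<-slack-one (2 * m) (Δ I ∸ 2) _ inner-debits≤ c<2m (2+m≤n⇒m≤n∸2 4+≤Δ)
  debit-bound (two-nodes (c₁ , c₁<2m , refl) (c₂ , c₂<2m , refl) x≢y 3+≤Δ 3+≤Δ′) =
    ∑<-slack-two (2 * m) (Δ I ∸ 2) _ inner-debits≤ c₁<2m c₂<2m (x≢y ∘ cong (x ∘ suc))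
                 (2+m≤n⇒m≤n∸2 3+≤Δ) (2+m≤n⇒m≤n∸2 3+≤Δ′)

  two-missing-debits : (d ≤ Δ I ∸ 2) ⊎ (d ≡ Δ I) ⊎ (4 ≤ Δ I) → length L ≤ 2 * m * (Δ I ∸ 2) ∸ 2
  two-missing-debits case =
    ≤-trans (length≤∑<-#transfers (x ∘ suc) (2 * m) (All.map inner-source L-in-P))
            (m+n≤o⇒m≤o∸n _ (debit-bound (two-missing case)))
    where
      inner-source : ∀ {e} → NodeOf I (mm P) (proj₁ e) × Transfer I (proj₁ e) (proj₂ e) →
                     IsInner (proj₁ e)
      inner-source (e∈P , tr) = covered-node⇒inner e∈P (transfer-source-covered tr)

lemma3 : (I : Instance) → 3 ≤ Δ I → MaxDegree≤ (G I) (Δ I) →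
    GreedyRun I → IsMaximumMatching I (mate I) → ComponentsOK I →
    (X : Component I) → (j : Fin (k I)) → CreatedAt I X j →
    (deg I (toℕ j) (sel I j) ≤ Δ I ∸ 2) ⊎ (deg I (toℕ j) (sel I j) ≡ Δ I) ⊎
    (4 ≤ Δ I) ⊎ IsOneOne I X →
    TwoMissingDebits I X
lemma3 I 3≤Δ max-deg R _ _ (one-one P) j created _ = one-one-debits I 3≤Δ max-deg R P j created
lemma3 I 3≤Δ max-deg R (is-matching , _) _ (mm P) j created case L L! L-in-P =
  MMComponent.two-missing-debits I 3≤Δ max-deg R is-matching P j created L L! L-in-P
    (Sum.map₂ (Sum.map₂ Sum.[ id , ⊥-elim ]′) case)
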